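{- Let $\mathbf{s}$ be a standard episturmian word whose directive word is written $\Delta(\mathbf{s})=x_1x_2\cdots=y_1^{d_1}y_2^{d_2}\cdots$ with letters $x_i,y_i$, integers $d_i\ge1$ and $y_i\neq y_{i+1}$ for all $i\ge1$, and put $g(m)=d_1+\cdots+d_{m-1}+1$ for $m\ge1$. Then for every $m\ge1$: (i) $u_{g(m+1)}=(h_{g(m)-1})^{d_m}u_{g(m)}=u_{g(m)}(\overline{h_{g(m)-1}})^{d_m}$; (ii) $u_{g(m+1)}=(h_{g(m)-1})^{d_m}(h_{g(m-1)-1})^{d_{m-1}}\cdots(h_0)^{d_1}=(\overline{h_0})^{d_1}(\overline{h_1})^{d_2}\cdots(\overline{h_{g(m)-1}})^{d_m}$; (iii) if $m\ge2$, $u_{g(m)-1}$ is a proper prefix of $h_{g(m)-1}$; (iv) $u_{g(m)}$ is a suffix of $(\overline{h_{g(m)-1}})^2$ and $u_{g(m+1)}$ is a suffix of $(\overline{h_{g(m)-1}})^{d_m+2}$.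
   Context: $\overline{w}$ denotes the reversal of a word $w$. An infinite word is episturmian if its set of factors is closed under reversal and for each length $\ell$ it has at most one right special factor of length $\ell$; it is standard if all its left special factors are prefixes of it. For a word $w$, $w^{(+)}$ is the shortest palindrome having $w$ as a prefix. If $u_1=\varepsilon,u_2,u_3,\ldots$ is the sequence of palindromic prefixes of a standard episturmian word $\mathbf{s}$ (in increasing length), there is an infinite word $\Delta(\mathbf{s})=x_1x_2\cdots$ (its directive word) with $u_{n+1}=(u_nx_n)^{(+)}$ for all $n\ge1$. For a letter $a$ let $\psi_a$ be the morphism with $\psi_a(a)=a$ and $\psi_a(x)=ax$ for $x\neq a$; let $\mu_0=\mathrm{Id}$, $\mu_n=\psi_{x_1}\cdots\psi_{x_n}$, and $h_n=\mu_n(x_{n+1})$ for $n\ge0$. -}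

module Defs where

open import Data.Nat using (ℕ; zero; suc; _+_; _∸_; _≤_; _<_)
open import Data.List using (List; []; _∷_; _++_; reverse; length; concatMap)
open import Data.Product using (Σ; ∃; _×_; _,_)
open import Data.Bool using (if_then_else_)
open import Relation.Nullary using (¬_; does)
open import Relation.Binary.PropositionalEquality using (_≡_; _≢_)
open import Relation.Binary.Definitions using (DecidableEquality)

-- Finite words: List A.  Infinite words: ℕ → A (position 0 = first letter).

IsPrefix : {A : Set} → List A → List A → Set
IsPrefix u v = ∃ λ t → u ++ t ≡ v

IsProperPrefix : {A : Set} → List A → List A → Set
IsProperPrefix u v = ∃ λ t → (t ≢ []) × (u ++ t ≡ v)

IsSuffix : {A : Set} → List A → List A → Set
IsSuffix u v = ∃ λ t → t ++ u ≡ v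

IsPalindrome : {A : Set} → List A → Set
IsPalindrome w = reverse w ≡ w

pow : {A : Set} → List A → ℕ → List A
pow w zero    = []
pow w (suc k) = w ++ pow w k

IsPalClosure : {A : Set} → List A → List A → Set
IsPalClosure w p =
  IsPalindrome p × IsPrefix w p ×
  (∀ q → IsPalindrome q → IsPrefix w q → length p ≤ length q)

block : {A : Set} → (ℕ → A) → ℕ → ℕ → List A
block s i zero    = []
block s i (suc n) = s i ∷ block s (suc i) n

Factor : {A : Set} → (ℕ → A) → List A → Set
Factor s w = ∃ λ i → block s i (length w) ≡ w

PrefixOf∞ : {A : Set} → List A → (ℕ → A) → Set
PrefixOf∞ w s = block s 0 (length w) ≡ w

RightSpecial : {A : Set} → (ℕ → A) → List A → Set
RightSpecial s w = ∃ λ a → ∃ λ b → (a ≢ b) × Factor s (w ++ a ∷ []) × Factor s (w ++ b ∷ [])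

LeftSpecial : {A : Set} → (ℕ → A) → List A → Set
LeftSpecial s w = ∃ λ a → ∃ λ b → (a ≢ b) × Factor s (a ∷ w) × Factor s (b ∷ w)

IsEpisturmian : {A : Set} → (ℕ → A) → Set
IsEpisturmian s =
  (∀ w → Factor s w → Factor s (reverse w)) ×
  (∀ v w → length v ≡ length w → RightSpecial s v → RightSpecial s w → v ≡ w)

IsStandard : {A : Set} → (ℕ → A) → Set
IsStandard s = ∀ w → LeftSpecial s w → PrefixOf∞ w s

-- u 1 = ε, u 2, u 3, ... is the sequence of palindromic prefixes of s,
-- in increasing length (index 0 unused).
IsPalPrefixSeq : {A : Set} → (ℕ → A) → (ℕ → List A) → Set
IsPalPrefixSeq s u =
  (u 1 ≡ []) ×
  (∀ n → 1 ≤ n → PrefixOf∞ (u n) s × IsPalindrome (u n)) ×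
  (∀ n → 1 ≤ n → length (u n) < length (u (suc n))) ×
  (∀ w → PrefixOf∞ w s → IsPalindrome w → ∃ λ n → (1 ≤ n) × (u n ≡ w))

-- x = x 1 x 2 ... is the directive word for u (index 0 unused):
-- u (n+1) = (u n x n)^(+) for all n ≥ 1
IsDirective : {A : Set} → (ℕ → List A) → (ℕ → A) → Set
IsDirective u x = ∀ n → 1 ≤ n → IsPalClosure (u n ++ x n ∷ []) (u (suc n))

ψ : {A : Set} → DecidableEquality A → A → List A → List A
ψ _≟_ a = concatMap (λ b → if does (b ≟ a) then a ∷ [] else a ∷ b ∷ [])

μ : {A : Set} → DecidableEquality A → (ℕ → A) → ℕ → List A → List A
μ _≟_ x zero    w = w
μ _≟_ x (suc n) w = μ _≟_ x n (ψ _≟_ (x (suc n)) w)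

h : {A : Set} → DecidableEquality A → (ℕ → A) → ℕ → List A
h _≟_ x n = μ _≟_ x n (x (suc n) ∷ [])

sumd : (ℕ → ℕ) → ℕ → ℕ
sumd d zero    = 0
sumd d (suc k) = sumd d k + d (suc k)

g : (ℕ → ℕ) → ℕ → ℕ
g d m = sumd d (m ∸ 1) + 1

IsRunDecomposition : {A : Set} → (ℕ → A) → (ℕ → A) → (ℕ → ℕ) → Set
IsRunDecomposition x y d =
  (∀ i → 1 ≤ i → 1 ≤ d i) ×
  (∀ i → 1 ≤ i → y i ≢ y (suc i)) ×
  (∀ m n → 1 ≤ m → g d m ≤ n → n < g d (suc m) → x n ≡ y m)

prodDown : {A : Set} → DecidableEquality A → (ℕ → A) → (ℕ → ℕ) → ℕ → List A
prodDown _≟_ x d zero    = []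
prodDown _≟_ x d (suc k) =
  pow (h _≟_ x (g d (suc k) ∸ 1)) (d (suc k)) ++ prodDown _≟_ x d k

prodUp : {A : Set} → DecidableEquality A → (ℕ → A) → (ℕ → ℕ) → ℕ → List A
prodUp _≟_ x d zero    = []
prodUp _≟_ x d (suc k) =
  prodUp _≟_ x d k ++ pow (reverse (h _≟_ x (g d (suc k) ∸ 1))) (d (suc k))

-- The key is Justin's formula u_{n+1} = h_{n-1} u_n, proved by induction together with a description
-- of the images of letters: if x_j is the last occurrence of c in x_1 ⋯ x_n then u_{n+1} = μ_n(c) u_j,
-- and if c does not occur there then μ_n(c) = u_{n+1} c. Indeed h_n u_{n+1} is then a palindrome
-- extending u_{n+1} x_{n+1} whose length is 2 |u_{n+1} x_{n+1}| minus the length of the longest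
-- palindromic suffix x_{n+1} u_j x_{n+1} (or x_{n+1}) of u_{n+1} x_{n+1}, so it is (u_{n+1} x_{n+1})⁽⁺⁾.
-- Within a run of the directive word h_n stays constant, which gives (i) and (ii). Distinct letters
-- a ≠ b satisfy |u_{n+1}| < |μ_n(a)| + |μ_n(b)|; at the start of a run this makes u_{g(m)-1} shorter
-- than h_{g(m)-1}, giving (iii), and u_{g(m)} at most twice as long as its period h_{g(m)-1}, giving (iv).
module Submission where

open import Defs
open import Data.Nat using (ℕ; zero; suc; _+_; _∸_; _≤_; _<_; _≤′_; ≤′-refl; ≤′-step; z≤n; s≤s)
open import Data.Nat.Properties
  using ( +-comm; +-assoc; +-suc; +-identityʳ; +-cancelˡ-≡; +-cancelˡ-≤; +-cancelʳ-≤
        ; +-mono-≤; +-monoʳ-≤; +-monoʳ-<; m≤m+n; m≤n+m; m<m+n; m+[n∸m]≡n; m+n∸n≡m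
        ; ≤-refl; ≤-reflexive; ≤-trans; ≤-antisym; ≤-total; ≤-pred; <⇒≤; <⇒≱; ≮⇒≥; ≰⇒>
        ; <-irrefl; n≤1+n; ≤⇒≤′; m<1+n⇒m<n∨m≡n; suc-injective; module ≤-Reasoning)
open import Data.List using (List; []; _∷_; _++_; _∷ʳ_; [_]; reverse; length; initLast; _∷ʳ′_)
open import Data.List.Properties
  using ( ++-assoc; ++-identityʳ; ++-cancelʳ; length-++; length-++-≤ˡ; length-reverse
        ; reverse-++; reverse-involutive; reverse-injective; unfold-reverse
        ; ∷-injective; ∷ʳ-injective; concatMap-++)
open import Data.Product using (_×_; _,_; ∃; proj₁; proj₂; map₁)
open import Data.Sum using (_⊎_; inj₁; inj₂)
open import Function using (_∘_)
open import Relation.Nullary using (Dec; yes; no; contradiction)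
open import Relation.Binary.PropositionalEquality
  using (_≡_; _≢_; refl; sym; trans; cong; cong₂; subst; subst₂; module ≡-Reasoning)
open import Relation.Binary.Definitions using (DecidableEquality)
open import Data.Nat.Tactic.RingSolver using (solve-∀)

<-suc-elim : {P : ℕ → Set} {n : ℕ} → (∀ i → i < n → P i) → P n → ∀ i → i < suc n → P i
<-suc-elim below at i i<1+n with m<1+n⇒m<n∨m≡n i<1+n
... | inj₁ i<n  = below i i<n
... | inj₂ refl = at

module _ {A : Set} where

  ++-split : (a b c d : List A) → a ++ b ≡ c ++ d → length a ≤ length c →
             ∃ λ e → c ≡ a ++ e × b ≡ e ++ d
  ++-split []      b c       d eq _         = c , refl , eq
  ++-split (x ∷ a) b (y ∷ c) d eq (s≤s a≤c) with refl , eq′ ← ∷-injective eq =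
    let e , c≡ae , b≡ed = ++-split a b c d eq′ a≤c in e , cong (x ∷_) c≡ae , b≡ed

  ++-injective : (a b c d : List A) → a ++ b ≡ c ++ d → length a ≡ length c → a ≡ c × b ≡ d
  ++-injective []      b []      d eq _ = refl , eq
  ++-injective (x ∷ a) b (y ∷ c) d eq l with refl , eq′ ← ∷-injective eq =
    map₁ (cong (x ∷_)) (++-injective a b c d eq′ (suc-injective l))

  length-∷ʳ : (w : List A) (c : A) → length (w ∷ʳ c) ≡ length w + 1
  length-∷ʳ w c = length-++ w

  IsPrefix-++ : (a b : List A) → IsPrefix a (a ++ b)
  IsPrefix-++ a b = b , refl

  IsPrefix-trans : ∀ {a b c : List A} → IsPrefix a b → IsPrefix b c → IsPrefix a c
  IsPrefix-trans {a} (t , refl) (t′ , refl) = t ++ t′ , sym (++-assoc a t t′)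

  IsPrefix-++⁺ : (c : List A) {a b : List A} → IsPrefix a b → IsPrefix (c ++ a) (c ++ b)
  IsPrefix-++⁺ c {a} (t , refl) = t , ++-assoc c a t

  IsPrefix-length : ∀ {a b : List A} → IsPrefix a b → length a ≤ length b
  IsPrefix-length {a} (t , refl) = length-++-≤ˡ a

  IsPrefix-nested : ∀ {a b w : List A} → IsPrefix a w → IsPrefix b w →
                    length a ≤ length b → IsPrefix a b
  IsPrefix-nested {a} {b} (t , a++t≡w) (t′ , b++t′≡w) a≤b =
    let e , b≡ae , _ = ++-split a t b t′ (trans a++t≡w (sym b++t′≡w)) a≤b in e , sym b≡ae

  IsPrefix⇒IsProperPrefix : ∀ {a b : List A} → IsPrefix a b → length a < length b →
                            IsProperPrefix a b
  IsPrefix⇒IsProperPrefix {a} (t , refl) a<b = t , t≢[] , refl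
    where
      t≢[] : t ≢ []
      t≢[] refl = <-irrefl (cong length (sym (++-identityʳ a))) a<b

  reverse-IsPrefix : ∀ {a b : List A} → IsPrefix a b → IsSuffix (reverse a) (reverse b)
  reverse-IsPrefix {a} (t , refl) = reverse t , sym (reverse-++ a t)

  pow-+ : (w : List A) (m n : ℕ) → pow w (m + n) ≡ pow w m ++ pow w n
  pow-+ w zero    n = refl
  pow-+ w (suc m) n = trans (cong (w ++_) (pow-+ w m n)) (sym (++-assoc w (pow w m) (pow w n)))

  pow-comm : (w : List A) (n : ℕ) → pow w n ++ w ≡ w ++ pow w n
  pow-comm w n = begin
    pow w n ++ w          ≡⟨ cong (pow w n ++_) (sym (++-identityʳ w)) ⟩
    pow w n ++ pow w 1    ≡⟨ sym (pow-+ w n 1) ⟩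
    pow w (n + 1)         ≡⟨ cong (pow w) (+-comm n 1) ⟩
    w ++ pow w n          ∎
    where open ≡-Reasoning

  reverse-pow : (w : List A) (n : ℕ) → reverse (pow w n) ≡ pow (reverse w) n
  reverse-pow w zero    = refl
  reverse-pow w (suc n) = begin
    reverse (w ++ pow w n)          ≡⟨ reverse-++ w (pow w n) ⟩
    reverse (pow w n) ++ reverse w  ≡⟨ cong (_++ reverse w) (reverse-pow w n) ⟩
    pow (reverse w) n ++ reverse w  ≡⟨ pow-comm (reverse w) n ⟩
    pow (reverse w) (suc n)         ∎
    where open ≡-Reasoning

  IsPrefix-period : (p w : List A) → IsPrefix p (w ++ p) → length p ≤ length w + length w →
                    IsPrefix p (w ++ w)
  IsPrefix-period p w (t , p++t≡w++p) p≤2w with ≤-total (length p) (length w)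
  ... | inj₁ p≤w =
    let e , w≡pe , _ = ++-split p t w p p++t≡w++p p≤w in
    IsPrefix-trans (e , sym w≡pe) (IsPrefix-++ w w)
  ... | inj₂ w≤p =
    let e , p≡we , p≡et = ++-split w p p t (sym p++t≡w++p) w≤p
        e≤w : length e ≤ length w
        e≤w = +-cancelˡ-≤ (length w) _ _
                (subst (_≤ length w + length w) (trans (cong length p≡we) (length-++ w)) p≤2w)
        e-prefix-w : IsPrefix e w
        e-prefix-w = IsPrefix-nested (t , sym p≡et) (e , sym p≡we) e≤w
    in subst (λ q → IsPrefix q (w ++ w)) (sym p≡we) (IsPrefix-++⁺ w e-prefix-w)

  palindrome-++-reverse : (w : List A) → IsPalindrome (w ++ reverse w)
  palindrome-++-reverse w = begin
    reverse (w ++ reverse w)                  ≡⟨ reverse-++ w (reverse w) ⟩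
    reverse (reverse w) ++ reverse w          ≡⟨ cong (_++ reverse w) (reverse-involutive w) ⟩
    w ++ reverse w                            ∎
    where open ≡-Reasoning

  palindrome-++-palindrome : ∀ {a b : List A} (w : List A) → IsPalindrome a → IsPalindrome b →
                             w ++ a ≡ b → IsPalindrome (w ++ b)
  palindrome-++-palindrome {a} {b} w pal-a pal-b w++a≡b = begin
    reverse (w ++ b)               ≡⟨ reverse-++ w b ⟩
    reverse b ++ reverse w         ≡⟨ cong (_++ reverse w) (trans pal-b (sym w++a≡b)) ⟩
    (w ++ a) ++ reverse w          ≡⟨ ++-assoc w a (reverse w) ⟩
    w ++ a ++ reverse w            ≡⟨ cong (λ a′ → w ++ a′ ++ reverse w) (sym pal-a) ⟩
    w ++ reverse a ++ reverse w    ≡⟨ cong (w ++_) (sym (reverse-++ w a)) ⟩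
    w ++ reverse (w ++ a)          ≡⟨ cong (λ b′ → w ++ reverse b′) w++a≡b ⟩
    w ++ reverse b                 ≡⟨ cong (w ++_) pal-b ⟩
    w ++ b                         ∎
    where open ≡-Reasoning

  palindrome-∷ʳ-++ : ∀ {a : List A} (c : A) → IsPalindrome a → IsPalindrome (a ∷ʳ c ++ a)
  palindrome-∷ʳ-++ {a} c pal-a = begin
    reverse ((a ∷ʳ c) ++ a)            ≡⟨ reverse-++ (a ∷ʳ c) a ⟩
    reverse a ++ reverse (a ∷ʳ c)      ≡⟨ cong (reverse a ++_) (reverse-++ a [ c ]) ⟩
    reverse a ++ c ∷ reverse a         ≡⟨ cong (λ a′ → a′ ++ c ∷ a′) pal-a ⟩
    a ++ c ∷ a                         ≡⟨ sym (++-assoc a [ c ] a) ⟩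
    (a ∷ʳ c) ++ a                      ∎
    where open ≡-Reasoning

  palindrome-inner : ∀ {a b : A} (w : List A) → IsPalindrome (a ∷ w ∷ʳ b) →
                     a ≡ b × IsPalindrome w
  palindrome-inner {a} {b} w pal =
    let b≡a , eq = ∷-injective (trans (sym reverse≡) pal)
    in sym b≡a , proj₁ (∷ʳ-injective (reverse w) w eq)
    where
      reverse≡ : reverse (a ∷ w ∷ʳ b) ≡ b ∷ (reverse w ∷ʳ a)
      reverse≡ = trans (unfold-reverse a (w ∷ʳ b)) (cong (_∷ʳ a) (reverse-++ w [ b ]))

  palindrome-split : (v z : List A) → IsPalindrome (v ++ z) → length z ≤ length v →
                     ∃ λ w → v ≡ reverse z ++ w × IsPalindrome w
  palindrome-split v z pal z≤v =
    let w , v≡ , reverse-v≡w++z = ++-split (reverse z) (reverse v) v z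
                                    (trans (sym (reverse-++ v z)) pal)
                                    (subst (_≤ length v) (sym (length-reverse z)) z≤v)
        reverse-v≡ : reverse v ≡ reverse w ++ z
        reverse-v≡ = begin
          reverse v                          ≡⟨ cong reverse v≡ ⟩
          reverse (reverse z ++ w)           ≡⟨ reverse-++ (reverse z) w ⟩
          reverse w ++ reverse (reverse z)   ≡⟨ cong (reverse w ++_) (reverse-involutive z) ⟩
          reverse w ++ z                     ∎
    in w , v≡ , ++-cancelʳ z (reverse w) w (trans (sym reverse-v≡) reverse-v≡w++z)
    where open ≡-Reasoning

  palindrome-unique : ∀ {v p q : List A} → IsPalindrome p → IsPalindrome q →
                      IsPrefix v p → IsPrefix v q →
                      length p ≡ length q → length p ≤ length v + length v → p ≡ q
  palindrome-unique {v} pal-p pal-q (z , refl) (z′ , refl) |p|≡|q| |p|≤2|v| = cong (v ++_) z≡z′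
    where
      |z|≡|z′| : length z ≡ length z′
      |z|≡|z′| = +-cancelˡ-≡ (length v) _ _ (trans (sym (length-++ v)) (trans |p|≡|q| (length-++ v)))
      z≤v : length z ≤ length v
      z≤v = +-cancelˡ-≤ (length v) _ _ (subst (_≤ length v + length v) (length-++ v) |p|≤2|v|)
      z≡z′ : z ≡ z′
      z≡z′ =
        let w  , v≡  , _ = palindrome-split v z  pal-p z≤v
            w′ , v≡′ , _ = palindrome-split v z′ pal-q (subst (_≤ length v) |z|≡|z′| z≤v)
            |rz|≡|rz′| = trans (length-reverse z) (trans |z|≡|z′| (sym (length-reverse z′)))
        in reverse-injective (proj₁ (++-injective _ w _ w′ (trans (sym v≡) v≡′) |rz|≡|rz′|))

  IsPalClosure-unique : ∀ {v p q : List A} → IsPalClosure v p → IsPalClosure v q → p ≡ q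
  IsPalClosure-unique {v} (pal-p , v-p , p-min) (pal-q , v-q , q-min) =
    palindrome-unique pal-p pal-q v-p v-q (≤-antisym (p-min _ pal-q v-q) (q-min _ pal-p v-p))
      (subst (_ ≤_) (trans (length-++ v) (cong (length v +_) (length-reverse v)))
        (p-min _ (palindrome-++-reverse v) (IsPrefix-++ v (reverse v))))

  -- |v⁽⁺⁾| = 2|v| − |w| for the longest palindromic suffix w of v.
  IsPalClosure-intro : ∀ {v P : List A} → IsPalindrome P → IsPrefix v P →
    (∀ w → IsPalindrome w → IsSuffix w v → length P + length w ≤ length v + length v) →
    IsPalClosure v P
  IsPalClosure-intro {v} {P} pal-P v-P bound = pal-P , v-P , minimal
    where
      open ≤-Reasoning
      minimal : ∀ q → IsPalindrome q → IsPrefix v q → length P ≤ length q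
      minimal q pal-q (z , refl) with ≤-total (length v) (length z)
      ... | inj₁ v≤z = begin
        length P                  ≤⟨ m≤m+n (length P) 0 ⟩
        length P + 0              ≤⟨ bound [] refl (v , ++-identityʳ v) ⟩
        length v + length v       ≤⟨ +-monoʳ-≤ (length v) v≤z ⟩
        length v + length z       ≡⟨ length-++ v ⟨
        length (v ++ z)           ∎
      ... | inj₂ z≤v =
        let w , v≡ , pal-w = palindrome-split v z pal-q z≤v
            |v|≡ : length v ≡ length z + length w
            |v|≡ = trans (cong length v≡)
                     (trans (length-++ (reverse z)) (cong (_+ length w) (length-reverse z)))
        in subst (length P ≤_) (sym (length-++ v)) (+-cancelʳ-≤ (length w) _ _ (begin
             length P + length w               ≤⟨ bound w pal-w (reverse z , sym v≡) ⟩
             length v + length v               ≡⟨ cong (length v +_) |v|≡ ⟩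
             length v + (length z + length w)  ≡⟨ +-assoc (length v) (length z) (length w) ⟨
             length v + length z + length w    ∎))

  palindromic-suffix-∷ʳ : ∀ {v w : List A} {c : A} →
    IsPalindrome v → IsPalindrome w → IsSuffix w (v ∷ʳ c) →
    length w ≤ 1 ⊎ ∃ λ r → w ≡ c ∷ r ∷ʳ c × IsPalindrome r × IsPrefix (r ∷ʳ c) v
  palindromic-suffix-∷ʳ {v} {w} {c} pal-v pal-w (t , t++w≡vc) = split-head w pal-w w++rt≡cv
    where
      open ≡-Reasoning
      w++rt≡cv : w ++ reverse t ≡ c ∷ v
      w++rt≡cv = begin
        w ++ reverse t           ≡⟨ cong (_++ reverse t) pal-w ⟨
        reverse w ++ reverse t   ≡⟨ reverse-++ t w ⟨
        reverse (t ++ w)         ≡⟨ cong reverse t++w≡vc ⟩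
        reverse (v ∷ʳ c)         ≡⟨ reverse-++ v [ c ] ⟩
        c ∷ reverse v            ≡⟨ cong (c ∷_) pal-v ⟩
        c ∷ v                    ∎
      split-head : ∀ w → IsPalindrome w → w ++ reverse t ≡ c ∷ v →
        length w ≤ 1 ⊎ ∃ λ r → w ≡ c ∷ r ∷ʳ c × IsPalindrome r × IsPrefix (r ∷ʳ c) v
      split-head []       _     _  = inj₁ z≤n
      split-head (a ∷ w₁) pal-w eq with refl , w₁++rt≡v ← ∷-injective eq | initLast w₁
      ... | []       = inj₁ (s≤s z≤n)
      ... | r ∷ʳ′ b with refl , pal-r ← palindrome-inner r pal-w =
        inj₂ (r , refl , pal-r , reverse t , w₁++rt≡v)

module _ {A : Set} (s : ℕ → A) where

  length-block : ∀ i n → length (block s i n) ≡ n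
  length-block i zero    = refl
  length-block i (suc n) = cong suc (length-block (suc i) n)

  block-+ : ∀ i m n → block s i (m + n) ≡ block s i m ++ block s (i + m) n
  block-+ i zero    n = cong (λ k → block s k n) (sym (+-identityʳ i))
  block-+ i (suc m) n = cong (s i ∷_)
    (trans (block-+ (suc i) m n) (cong (λ k → block s (suc i) m ++ block s k n) (sym (+-suc i m))))

  PrefixOf∞-IsPrefix : ∀ {a b : List A} → PrefixOf∞ a s → PrefixOf∞ b s →
                       length a ≤ length b → IsPrefix a b
  PrefixOf∞-IsPrefix {a} {b} a-s b-s a≤b = rest , (begin
    a ++ rest                                      ≡⟨ cong (_++ rest) a-s ⟨
    block s 0 (length a) ++ rest                   ≡⟨ block-+ 0 (length a) (length b ∸ length a) ⟨
    block s 0 (length a + (length b ∸ length a))   ≡⟨ cong (block s 0) (m+[n∸m]≡n a≤b) ⟩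
    block s 0 (length b)                           ≡⟨ b-s ⟩
    b                                              ∎)
    where
      open ≡-Reasoning
      rest = block s (length a) (length b ∸ length a)

  PrefixOf∞-unique : ∀ {a b : List A} → PrefixOf∞ a s → PrefixOf∞ b s →
                     length a ≡ length b → a ≡ b
  PrefixOf∞-unique a-s b-s |a|≡|b| = trans (sym a-s) (trans (cong (block s 0) |a|≡|b|) b-s)

  IsPrefix-PrefixOf∞ : ∀ {a b : List A} → IsPrefix a b → PrefixOf∞ b s → PrefixOf∞ a s
  IsPrefix-PrefixOf∞ {a} (t , refl) ab-s =
    proj₁ (++-injective _ _ a t split-block (length-block 0 (length a)))
    where
      split-block : block s 0 (length a) ++ block s (length a) (length t) ≡ a ++ t
      split-block = trans (sym (block-+ 0 (length a) (length t)))
                          (trans (cong (block s 0) (sym (length-++ a))) ab-s)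

-- U n and X n stand for u_{n+1} and x_{n+1}: shifted to start at 0, so that h_n = μ_n(X n).
module PalindromicPrefixes {A : Set} (s : ℕ → A) (u : ℕ → List A) (pal-prefixes : IsPalPrefixSeq s u)
  where

  U : ℕ → List A
  U n = u (suc n)

  U-zero : U 0 ≡ []
  U-zero = proj₁ pal-prefixes

  U-prefix∞ : ∀ n → PrefixOf∞ (U n) s
  U-prefix∞ n = proj₁ (proj₁ (proj₂ pal-prefixes) (suc n) (s≤s z≤n))

  U-palindrome : ∀ n → IsPalindrome (U n)
  U-palindrome n = proj₂ (proj₁ (proj₂ pal-prefixes) (suc n) (s≤s z≤n))

  U-length-< : ∀ n → length (U n) < length (U (suc n))
  U-length-< n = proj₁ (proj₂ (proj₂ pal-prefixes)) (suc n) (s≤s z≤n)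

  U-complete : ∀ w → PrefixOf∞ w s → IsPalindrome w → ∃ λ i → U i ≡ w
  U-complete w w-s pal-w with proj₂ (proj₂ (proj₂ pal-prefixes)) w w-s pal-w
  ... | suc i , _ , Ui≡w = i , Ui≡w

  U-length-mono : ∀ {i j} → i ≤ j → length (U i) ≤ length (U j)
  U-length-mono i≤j = mono (≤⇒≤′ i≤j)
    where
      mono : ∀ {i j} → i ≤′ j → length (U i) ≤ length (U j)
      mono ≤′-refl        = ≤-refl
      mono (≤′-step i≤′j) = ≤-trans (mono i≤′j) (<⇒≤ (U-length-< _))

  U-length-<⇒< : ∀ {i j} → length (U i) < length (U j) → i < j
  U-length-<⇒< |Ui|<|Uj| = ≰⇒> (λ j≤i → <⇒≱ |Ui|<|Uj| (U-length-mono j≤i))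

  U-IsPrefix : ∀ {i j} → i ≤ j → IsPrefix (U i) (U j)
  U-IsPrefix i≤j = PrefixOf∞-IsPrefix s (U-prefix∞ _) (U-prefix∞ _) (U-length-mono i≤j)

module DirectiveWord {A : Set} (_≟_ : DecidableEquality A) (s : ℕ → A) (u : ℕ → List A)
  (pal-prefixes : IsPalPrefixSeq s u) (x : ℕ → A) (directive : IsDirective u x) where

  open PalindromicPrefixes s u pal-prefixes public

  X : ℕ → A
  X n = x (suc n)

  M : ℕ → A → List A
  M n c = μ _≟_ x n [ c ]

  H : ℕ → List A
  H n = h _≟_ x n

  U-closure : ∀ n → IsPalClosure (U n ∷ʳ X n) (U (suc n))
  U-closure n = directive (suc n) (s≤s z≤n)

  U-∷ʳ-X-IsPrefix : ∀ n → IsPrefix (U n ∷ʳ X n) (U (suc n))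
  U-∷ʳ-X-IsPrefix n = proj₁ (proj₂ (U-closure n))

  X-IsPrefix : ∀ {i n c} → IsPrefix (U i ∷ʳ c) (U n) → X i ≡ c
  X-IsPrefix {i} {n} {c} Uic-prefix =
    proj₂ (∷ʳ-injective (U i) (U i) (PrefixOf∞-unique s Uix-s Uic-s |Uix|≡|Uic|))
    where
      Uix-s = IsPrefix-PrefixOf∞ s (U-∷ʳ-X-IsPrefix i) (U-prefix∞ (suc i))
      Uic-s = IsPrefix-PrefixOf∞ s Uic-prefix (U-prefix∞ n)
      |Uix|≡|Uic| = trans (length-++ (U i)) (sym (length-++ (U i)))

  μ-++ : ∀ n (v w : List A) → μ _≟_ x n (v ++ w) ≡ μ _≟_ x n v ++ μ _≟_ x n w
  μ-++ zero    v w = refl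
  μ-++ (suc n) v w = trans (cong (μ _≟_ x n) (concatMap-++ _ v w)) (μ-++ n _ _)

  M-suc-X : ∀ n → M (suc n) (X n) ≡ H n
  M-suc-X n with X n ≟ X n
  ... | yes _     = refl
  ... | no Xn≢Xn = contradiction refl Xn≢Xn

  M-suc-≢ : ∀ {n c} → c ≢ X n → M (suc n) c ≡ H n ++ M n c
  M-suc-≢ {n} {c} c≢Xn with c ≟ X n
  ... | yes c≡Xn = contradiction c≡Xn c≢Xn
  ... | no _     = μ-++ n [ X n ] [ c ]

  palindrome-∷ʳ-IsPrefix-U : ∀ {n c r} → IsPalindrome r → IsPrefix (r ∷ʳ c) (U n) →
                             ∃ λ i → U i ≡ r × i < n × X i ≡ c
  palindrome-∷ʳ-IsPrefix-U {n} {c} {r} pal-r rc-prefix = as-U (U-complete r r-prefix∞ pal-r)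
    where
      r-prefix∞ : PrefixOf∞ r s
      r-prefix∞ = IsPrefix-PrefixOf∞ s (IsPrefix-trans (IsPrefix-++ r [ c ]) rc-prefix) (U-prefix∞ n)
      |r|<|Un| : length r < length (U n)
      |r|<|Un| = ≤-trans (≤-reflexive (trans (+-comm 1 (length r)) (sym (length-∷ʳ r c))))
                         (IsPrefix-length rc-prefix)
      as-U : (∃ λ i → U i ≡ r) → ∃ λ i → U i ≡ r × i < n × X i ≡ c
      as-U (i , refl) = i , refl , U-length-<⇒< |r|<|Un| , X-IsPrefix rc-prefix

  U-palindromic-suffix : ∀ {n c w} → IsPalindrome w → IsSuffix w (U n ∷ʳ c) →
    length w ≤ 1 ⊎ ∃ λ i → i < n × X i ≡ c × length w ≡ 2 + length (U i)
  U-palindromic-suffix {n} {c} pal-w w-suffix with palindromic-suffix-∷ʳ (U-palindrome n) pal-w w-suffix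
  ... | inj₁ short = inj₁ short
  ... | inj₂ (r , refl , pal-r , rc-prefix) =
    let i , Ui≡r , i<n , Xi≡c = palindrome-∷ʳ-IsPrefix-U pal-r rc-prefix
        |rc|≡ = trans (length-∷ʳ r c) (trans (+-comm (length r) 1) (cong (suc ∘ length) (sym Ui≡r)))
    in inj₂ (i , i<n , Xi≡c , cong suc |rc|≡)

  data LetterImage (n : ℕ) (c : A) : Set where
    last-occurrence : ∀ j → M n c ++ U j ≡ U n → IsPrefix (U j ∷ʳ c) (U n) →
                      (∀ i → i < n → j < i → X i ≢ c) → LetterImage n c
    no-occurrence   : M n c ≡ U n ∷ʳ c → (∀ i → i < n → X i ≢ c) → LetterImage n c

  closure-length-last : ∀ h un uj w → h + uj ≡ un → w ≤ 2 + uj →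
                        (h + un) + w ≤ (un + 1) + (un + 1)
  closure-length-last h un uj w refl w≤ =
    ≤-trans (+-monoʳ-≤ (h + (h + uj)) w≤) (≤-reflexive (eq h uj))
    where
      eq : ∀ h uj → (h + (h + uj)) + (2 + uj) ≡ (h + uj + 1) + (h + uj + 1)
      eq = solve-∀

  closure-length-none : ∀ un w → w ≤ 1 → ((un + 1) + un) + w ≤ (un + 1) + (un + 1)
  closure-length-none un w w≤1 = ≤-trans (+-monoʳ-≤ ((un + 1) + un) w≤1) (≤-reflexive (eq un))
    where
      eq : ∀ un → ((un + 1) + un) + 1 ≡ (un + 1) + (un + 1)
      eq = solve-∀

  H-++-U-closure : ∀ n → LetterImage n (X n) → IsPalClosure (U n ∷ʳ X n) (H n ++ U n)
  H-++-U-closure n (last-occurrence j H++Uj≡Un Ujc-prefix absent) =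
    IsPalClosure-intro (palindrome-++-palindrome (H n) (U-palindrome j) (U-palindrome n) H++Uj≡Un)
      prefix bound
    where
      prefix : IsPrefix (U n ∷ʳ X n) (H n ++ U n)
      prefix = subst (λ w → IsPrefix (w ∷ʳ X n) (H n ++ U n)) H++Uj≡Un
        (subst (λ w → IsPrefix w (H n ++ U n)) (sym (++-assoc (H n) (U j) [ X n ]))
          (IsPrefix-++⁺ (H n) Ujc-prefix))
      |H|+|Uj|≡|Un| : length (H n) + length (U j) ≡ length (U n)
      |H|+|Uj|≡|Un| = trans (sym (length-++ (H n))) (cong length H++Uj≡Un)
      short : ∀ {w} → IsPalindrome w → IsSuffix w (U n ∷ʳ X n) → length w ≤ 2 + length (U j)
      short pal-w w-suffix with U-palindromic-suffix pal-w w-suffix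
      ... | inj₁ |w|≤1 = ≤-trans |w|≤1 (s≤s z≤n)
      ... | inj₂ (i , i<n , Xi≡Xn , |w|≡) =
        subst (_≤ 2 + length (U j)) (sym |w|≡)
          (+-monoʳ-≤ 2 (U-length-mono (≮⇒≥ (λ j<i → absent i i<n j<i Xi≡Xn))))
      bound : ∀ w → IsPalindrome w → IsSuffix w (U n ∷ʳ X n) →
              length (H n ++ U n) + length w ≤ length (U n ∷ʳ X n) + length (U n ∷ʳ X n)
      bound w pal-w w-suffix rewrite length-++ (H n) {U n} | length-∷ʳ (U n) (X n) =
        closure-length-last _ _ _ _ |H|+|Uj|≡|Un| (short pal-w w-suffix)
  H-++-U-closure n (no-occurrence H≡UnX absent) rewrite H≡UnX =
    IsPalClosure-intro (palindrome-∷ʳ-++ (X n) (U-palindrome n)) (IsPrefix-++ (U n ∷ʳ X n) (U n)) bound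
    where
      bound : ∀ w → IsPalindrome w → IsSuffix w (U n ∷ʳ X n) →
              length (U n ∷ʳ X n ++ U n) + length w ≤ length (U n ∷ʳ X n) + length (U n ∷ʳ X n)
      bound w pal-w w-suffix with U-palindromic-suffix pal-w w-suffix
      ... | inj₂ (i , i<n , Xi≡Xn , _) = contradiction Xi≡Xn (absent i i<n)
      ... | inj₁ |w|≤1 rewrite length-++ (U n ∷ʳ X n) {U n} | length-∷ʳ (U n) (X n) =
        closure-length-none (length (U n)) (length w) |w|≤1

  letterImage : ∀ n c → LetterImage n c
  U-suc≡H++U : ∀ n → U (suc n) ≡ H n ++ U n

  U-suc≡H++U n = IsPalClosure-unique (U-closure n) (H-++-U-closure n (letterImage n (X n)))

  letterImage zero    c = no-occurrence (cong (_∷ʳ c) (sym U-zero)) (λ _ ())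
  letterImage (suc n) c with c ≟ X n
  ... | yes refl = last-occurrence n (trans (cong (_++ U n) (M-suc-X n)) (sym (U-suc≡H++U n)))
                     (U-∷ʳ-X-IsPrefix n) (λ i i<1+n n<i → contradiction (≤-pred i<1+n) (<⇒≱ n<i))
  ... | no c≢Xn with letterImage n c
  ...   | last-occurrence j M++Uj≡Un Ujc-prefix absent =
    last-occurrence j M++Uj≡U-suc (IsPrefix-trans Ujc-prefix (U-IsPrefix (n≤1+n n)))
      (<-suc-elim absent (λ _ → c≢Xn ∘ sym))
    where
      open ≡-Reasoning
      M++Uj≡U-suc : M (suc n) c ++ U j ≡ U (suc n)
      M++Uj≡U-suc = begin
        M (suc n) c ++ U j       ≡⟨ cong (_++ U j) (M-suc-≢ c≢Xn) ⟩
        (H n ++ M n c) ++ U j    ≡⟨ ++-assoc (H n) (M n c) (U j) ⟩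
        H n ++ M n c ++ U j      ≡⟨ cong (H n ++_) M++Uj≡Un ⟩
        H n ++ U n               ≡⟨ U-suc≡H++U n ⟨
        U (suc n)                ∎
  ...   | no-occurrence M≡Unc absent =
    no-occurrence M≡U-suc-c (<-suc-elim absent (c≢Xn ∘ sym))
    where
      open ≡-Reasoning
      M≡U-suc-c : M (suc n) c ≡ U (suc n) ∷ʳ c
      M≡U-suc-c = begin
        M (suc n) c          ≡⟨ M-suc-≢ c≢Xn ⟩
        H n ++ M n c         ≡⟨ cong (H n ++_) M≡Unc ⟩
        H n ++ U n ∷ʳ c      ≡⟨ ++-assoc (H n) (U n) [ c ] ⟨
        (H n ++ U n) ∷ʳ c    ≡⟨ cong (_∷ʳ c) (U-suc≡H++U n) ⟨
        U (suc n) ∷ʳ c       ∎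

  M-IsPrefix : ∀ n c → IsPrefix (M n c) (U n ∷ʳ c)
  M-IsPrefix n c with letterImage n c
  ... | last-occurrence j M++Uj≡Un _ _ = IsPrefix-trans (U j , M++Uj≡Un) (IsPrefix-++ (U n) [ c ])
  ... | no-occurrence M≡Unc _          = [] , trans (++-identityʳ _) M≡Unc

  length-M-suc-≢ : ∀ {n c} → c ≢ X n → length (M (suc n) c) ≡ length (H n) + length (M n c)
  length-M-suc-≢ {n} c≢Xn = trans (cong length (M-suc-≢ c≢Xn)) (length-++ (H n))

  length-M-suc : ∀ n c → length (M n c) ≤ length (M (suc n) c)
  length-M-suc n c = by-cases (c ≟ X n)
    where
      by-cases : Dec (c ≡ X n) → length (M n c) ≤ length (M (suc n) c)
      by-cases (yes refl) = ≤-reflexive (cong length (sym (M-suc-X n)))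
      by-cases (no c≢Xn)  =
        ≤-trans (m≤n+m _ (length (H n))) (≤-reflexive (sym (length-M-suc-≢ c≢Xn)))

  length-U-suc : ∀ n → length (U (suc n)) ≡ length (H n) + length (U n)
  length-U-suc n = trans (cong length (U-suc≡H++U n)) (length-++ (H n))

  length-U-suc<M+M : ∀ n {c c′} → c′ ≢ X n → length (U n) < length (M n c) + length (M n c′) →
                     length (U (suc n)) < length (M (suc n) c) + length (M (suc n) c′)
  length-U-suc<M+M n {c} {c′} c′≢Xn IH = begin-strict
    length (U (suc n))                                 ≡⟨ length-U-suc n ⟩
    length (H n) + length (U n)                        <⟨ +-monoʳ-< (length (H n)) IH ⟩
    length (H n) + (length (M n c) + length (M n c′))  ≡⟨ rearrange (length (H n)) (length (M n c)) _ ⟩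
    length (M n c) + (length (H n) + length (M n c′))  ≤⟨ +-mono-≤ (length-M-suc n c) |M-suc-c′|≥ ⟩
    length (M (suc n) c) + length (M (suc n) c′)       ∎
    where
      |M-suc-c′|≥ = ≤-reflexive (sym (length-M-suc-≢ c′≢Xn))
      open ≤-Reasoning
      rearrange : ∀ a b c → a + (b + c) ≡ b + (a + c)
      rearrange = solve-∀

  length-U<M+M : ∀ n {c c′} → c ≢ c′ → length (U n) < length (M n c) + length (M n c′)
  length-U<M+M zero    _ rewrite U-zero = s≤s z≤n
  length-U<M+M (suc n) {c} {c′} c≢c′ = by-cases (c′ ≟ X n)
    where
      IH = length-U<M+M n c≢c′
      by-cases : Dec (c′ ≡ X n) → length (U (suc n)) < length (M (suc n) c) + length (M (suc n) c′)
      by-cases (no c′≢Xn) = length-U-suc<M+M n c′≢Xn IH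
      by-cases (yes refl) = subst (length (U (suc n)) <_) (+-comm (length (M (suc n) c′)) _)
        (length-U-suc<M+M n c≢c′ (subst (length (U n) <_) (+-comm (length (M n c)) _) IH))

  length-U<M-suc : ∀ {n c} → c ≢ X n → length (U n) < length (M (suc n) c)
  length-U<M-suc {n} c≢Xn =
    subst (length (U n) <_) (sym (length-M-suc-≢ c≢Xn)) (length-U<M+M n (c≢Xn ∘ sym))

  U-IsProperPrefix-M-suc : ∀ {n c} → c ≢ X n → IsProperPrefix (U n) (M (suc n) c)
  U-IsProperPrefix-M-suc {n} {c} c≢Xn =
    IsPrefix⇒IsProperPrefix
      (IsPrefix-nested (IsPrefix-trans (U-IsPrefix (n≤1+n n)) (IsPrefix-++ (U (suc n)) [ c ]))
        (M-IsPrefix (suc n) c) (<⇒≤ (length-U<M-suc c≢Xn)))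
      (length-U<M-suc c≢Xn)

  U-IsPrefix-H-square : ∀ {n} → X (suc n) ≢ X n →
                        IsPrefix (U (suc n)) (H (suc n) ++ H (suc n))
  U-IsPrefix-H-square {n} X≢ = IsPrefix-period (U (suc n)) (H (suc n))
    (subst (IsPrefix (U (suc n))) (U-suc≡H++U (suc n)) (U-IsPrefix (n≤1+n (suc n))))
    (begin
      length (U (suc n))                      ≡⟨ length-U-suc n ⟩
      length (H n) + length (U n)             ≤⟨ +-mono-≤ |Hn|≤|H-suc| (<⇒≤ (length-U<M-suc X≢)) ⟩
      length (H (suc n)) + length (H (suc n)) ∎)
    where
      open ≤-Reasoning
      |Hn|≤|H-suc| : length (H n) ≤ length (H (suc n))
      |Hn|≤|H-suc| = ≤-trans (m≤m+n _ _) (≤-reflexive (sym (length-M-suc-≢ X≢)))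

g-suc : ∀ d k → g d (suc k) ≡ suc (sumd d k)
g-suc d k = +-comm (sumd d k) 1

g-suc∸1 : ∀ d k → g d (suc k) ∸ 1 ≡ sumd d k
g-suc∸1 d k = m+n∸n≡m (sumd d k) 1

module Runs {A : Set} (_≟_ : DecidableEquality A) (s : ℕ → A) (u : ℕ → List A)
  (pal-prefixes : IsPalPrefixSeq s u) (x : ℕ → A) (directive : IsDirective u x)
  (y : ℕ → A) (d : ℕ → ℕ) (runs : IsRunDecomposition x y d) where

  open DirectiveWord _≟_ s u pal-prefixes x directive public

  X-run : ∀ k n → sumd d k ≤ n → n < sumd d (suc k) → X n ≡ y (suc k)
  X-run k n start≤n n<end = proj₂ (proj₂ runs) (suc k) (suc n) (s≤s z≤n)
    (subst (_≤ suc n) (+-comm 1 (sumd d k)) (s≤s start≤n))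
    (subst (suc n <_) (+-comm 1 (sumd d (suc k))) (s≤s n<end))

  H-run : ∀ k j → j < d (suc k) → H (sumd d k + j) ≡ H (sumd d k)
  H-run k zero    _     = cong H (+-identityʳ (sumd d k))
  H-run k (suc j) 1+j<d = begin
    H (a + suc j)                      ≡⟨ cong H (+-suc a j) ⟩
    M (suc (a + j)) (X (suc (a + j)))  ≡⟨ cong (M (suc (a + j))) X-same ⟩
    M (suc (a + j)) (X (a + j))        ≡⟨ M-suc-X (a + j) ⟩
    H (a + j)                          ≡⟨ H-run k j j<d ⟩
    H a                                ∎
    where
      open ≡-Reasoning
      a = sumd d k
      j<d = ≤-trans (n≤1+n (suc j)) 1+j<d
      1+a+j<end : suc (a + j) < a + d (suc k)
      1+a+j<end = subst (_< a + d (suc k)) (+-suc a j) (+-monoʳ-< a 1+j<d)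
      X-same : X (suc (a + j)) ≡ X (a + j)
      X-same = trans (X-run k _ (≤-trans (m≤m+n a j) (n≤1+n _)) 1+a+j<end)
                     (sym (X-run k _ (m≤m+n a j) (+-monoʳ-< a j<d)))

  U-run : ∀ k j → j ≤ d (suc k) → U (sumd d k + j) ≡ pow (H (sumd d k)) j ++ U (sumd d k)
  U-run k zero    _   = cong U (+-identityʳ (sumd d k))
  U-run k (suc j) j<d = begin
    U (a + suc j)                      ≡⟨ cong U (+-suc a j) ⟩
    U (suc (a + j))                    ≡⟨ U-suc≡H++U (a + j) ⟩
    H (a + j) ++ U (a + j)             ≡⟨ cong₂ _++_ (H-run k j j<d) (U-run k j (<⇒≤ j<d)) ⟩
    H a ++ pow (H a) j ++ U a          ≡⟨ ++-assoc (H a) (pow (H a) j) (U a) ⟨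
    pow (H a) (suc j) ++ U a           ∎
    where
      open ≡-Reasoning
      a = sumd d k

  U-run-end : ∀ k → U (sumd d (suc k)) ≡ pow (H (sumd d k)) (d (suc k)) ++ U (sumd d k)
  U-run-end k = U-run k (d (suc k)) ≤-refl

  U-run-end-reverse : ∀ k →
    U (sumd d (suc k)) ≡ U (sumd d k) ++ pow (reverse (H (sumd d k))) (d (suc k))
  U-run-end-reverse k = begin
    U (sumd d (suc k))                       ≡⟨ U-palindrome _ ⟨
    reverse (U (sumd d (suc k)))             ≡⟨ cong reverse (U-run-end k) ⟩
    reverse (pow (H a) e ++ U a)             ≡⟨ reverse-++ (pow (H a) e) (U a) ⟩
    reverse (U a) ++ reverse (pow (H a) e)   ≡⟨ cong₂ _++_ (U-palindrome a) (reverse-pow (H a) e) ⟩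
    U a ++ pow (reverse (H a)) e             ∎
    where
      open ≡-Reasoning
      a = sumd d k
      e = d (suc k)

  U-prodDown : ∀ k → U (sumd d k) ≡ prodDown _≟_ x d k
  U-prodDown zero    = U-zero
  U-prodDown (suc k) = trans (U-run-end k)
    (cong₂ (λ i w → pow (H i) (d (suc k)) ++ w) (sym (g-suc∸1 d k)) (U-prodDown k))

  U-prodUp : ∀ k → U (sumd d k) ≡ prodUp _≟_ x d k
  U-prodUp zero    = U-zero
  U-prodUp (suc k) = trans (U-run-end-reverse k)
    (cong₂ (λ i w → w ++ pow (reverse (H i)) (d (suc k))) (sym (g-suc∸1 d k)) (U-prodUp k))

  run-end-suc : ∀ k → ∃ λ p → sumd d (suc k) ≡ suc p
  run-end-suc k with sumd d (suc k) | m<m+n (sumd d k) {d (suc k)} (proj₁ runs (suc k) (s≤s z≤n))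
  ... | suc p | _ = p , refl

  X-run-boundary : ∀ k p → sumd d (suc k) ≡ suc p → X (suc p) ≢ X p
  X-run-boundary k p end≡ X≡ =
    proj₁ (proj₂ runs) (suc k) (s≤s z≤n) (trans (sym X-last) (trans (sym X≡) X-first))
    where
      d-pos : ∀ i → 1 ≤ d (suc i)
      d-pos i = proj₁ runs (suc i) (s≤s z≤n)
      X-first : X (suc p) ≡ y (suc (suc k))
      X-first = X-run (suc k) (suc p) (≤-reflexive end≡)
        (subst (_< sumd d (suc k) + d (suc (suc k))) end≡ (m<m+n (sumd d (suc k)) (d-pos (suc k))))
      X-last : X p ≡ y (suc k)
      X-last = X-run k p
        (≤-pred (subst₂ _≤_ (+-comm (sumd d k) 1) end≡ (+-monoʳ-≤ (sumd d k) (d-pos k))))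
        (≤-reflexive (sym end≡))

  u-IsProperPrefix-H : ∀ k → 2 ≤ suc k → IsProperPrefix (u (sumd d k)) (H (sumd d k))
  u-IsProperPrefix-H zero    (s≤s ())
  u-IsProperPrefix-H (suc k) _ with p , end≡ ← run-end-suc k rewrite end≡ =
    U-IsProperPrefix-M-suc (X-run-boundary k p end≡)

  U-suffix-square : ∀ k → IsSuffix (U (sumd d k)) (pow (reverse (H (sumd d k))) 2)
  U-suffix-square zero    rewrite U-zero = _ , ++-identityʳ _
  U-suffix-square (suc k) with p , end≡ ← run-end-suc k rewrite end≡ =
    subst₂ IsSuffix (U-palindrome (suc p)) reverse-square
      (reverse-IsPrefix (subst (λ w → IsPrefix (U (suc p)) (H (suc p) ++ w)) (sym (++-identityʳ _))
         (U-IsPrefix-H-square (X-run-boundary k p end≡))))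
    where
      reverse-square : reverse (pow (H (suc p)) 2) ≡ pow (reverse (H (suc p))) 2
      reverse-square = reverse-pow (H (suc p)) 2

  U-suffix-power : ∀ k →
    IsSuffix (U (sumd d (suc k))) (pow (reverse (H (sumd d k))) (d (suc k) + 2))
  U-suffix-power k with t , t++U≡ ← U-suffix-square k = t , (begin
    t ++ U (sumd d (suc k))           ≡⟨ cong (t ++_) (U-run-end-reverse k) ⟩
    t ++ U a ++ pow R e               ≡⟨ ++-assoc t (U a) (pow R e) ⟨
    (t ++ U a) ++ pow R e             ≡⟨ cong (_++ pow R e) t++U≡ ⟩
    pow R 2 ++ pow R e                ≡⟨ pow-+ R 2 e ⟨
    pow R (2 + e)                     ≡⟨ cong (pow R) (+-comm 2 e) ⟩
    pow R (e + 2)                     ∎)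
    where
      open ≡-Reasoning
      a = sumd d k
      e = d (suc k)
      R = reverse (H a)

lemma4 : {A : Set} (_≟_ : DecidableEquality A)
    (s : ℕ → A) → IsEpisturmian s → IsStandard s →
    (u : ℕ → List A) → IsPalPrefixSeq s u →
    (x : ℕ → A) → IsDirective u x →
    (y : ℕ → A) (d : ℕ → ℕ) → IsRunDecomposition x y d →
    ∀ m → 1 ≤ m →
    ((u (g d (suc m)) ≡ pow (h _≟_ x (g d m ∸ 1)) (d m) ++ u (g d m))
    × (u (g d (suc m)) ≡ u (g d m) ++ pow (reverse (h _≟_ x (g d m ∸ 1))) (d m)))
    × ((u (g d (suc m)) ≡ prodDown _≟_ x d m)
    × (u (g d (suc m)) ≡ prodUp _≟_ x d m))
    × (2 ≤ m → IsProperPrefix (u (g d m ∸ 1)) (h _≟_ x (g d m ∸ 1)))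
    × (IsSuffix (u (g d m)) (pow (reverse (h _≟_ x (g d m ∸ 1))) 2)
    × IsSuffix (u (g d (suc m))) (pow (reverse (h _≟_ x (g d m ∸ 1))) (d m + 2)))
-- After the rewrite, g d (suc k) ∸ 1 computes to sumd d k, also
-- inside prodDown and prodUp.
lemma4 _≟_ s _ _ u pal-prefixes x directive y d runs (suc k) _
  rewrite g-suc d k | g-suc d (suc k) =
    (U-run-end k , U-run-end-reverse k) ,
    (trans (U-run-end k) (cong (pow (H (sumd d k)) (d (suc k)) ++_) (U-prodDown k)) ,
     trans (U-run-end-reverse k) (cong (_++ pow (reverse (H (sumd d k))) (d (suc k))) (U-prodUp k))) ,
    u-IsProperPrefix-H k , U-suffix-square k , U-suffix-power k
  where open Runs _≟_ s u pal-prefixes x directive y d runs
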